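{- Let $q$ be a prime power, $h\ge2$, $l\ge1$, and let $\alpha\in\mathbb{F}_{q^h}\setminus\mathbb{F}_q$ with $[\mathbb{F}_q(\alpha):\mathbb{F}_q]=s$. Let $1\le t_1\le t_2\le\dots\le t_{l+1}\le h$ be integers with $t_i+t_j\le s+1$ for all $i\neq j$. Let $L$ be the set of points of $\mathrm{PG}(l,q^h)$ with coordinates $\langle(f_1(\alpha),\dots,f_{l+1}(\alpha))\rangle$, where $f_i\in\mathbb{F}_q[X]$ has degree at most $t_i-1$ and not all $f_i(\alpha)$ are zero. Then there is a bijection between the set of points of $L$ and the set $$S=\{(f_1,\dots,f_{l+1})\mid f_i\in\mathbb{F}_q[X],\ \deg(f_i)\le t_i-1,\ (f_1,\dots,f_{l+1})\text{ is in reduced form}\}.$$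
   Context: A tuple of polynomials $(f_1,\dots,f_{l+1})$ over $\mathbb{F}_q$ is in reduced form if its first non-zero polynomial is monic and $\gcd(f_1,\dots,f_{l+1})=1$ (gcd taken monic). Zero polynomials are allowed. -}

module Defs where

open import Level using (Level; _⊔_) renaming (suc to lsuc)
open import Data.Nat using (ℕ; zero; suc; _≤_; _<_)
open import Data.Fin using (Fin; toℕ) renaming (_<_ to _<ᶠ_)
open import Data.List using (List; []; _∷_; length)
open import Data.Vec using (Vec; toList; lookup)
open import Data.Product using (Σ; ∃; _×_; _,_)
open import Relation.Nullary using (¬_)
open import Relation.Binary.PropositionalEquality using (_≡_; _≢_)
open import Algebra.Structures using (IsCommutativeRing)

record Field (c : Level) : Set (lsuc c) where
  infixl 7 _*_
  infixl 6 _+_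
  field
    Carrier : Set c
    _+_ _*_ : Carrier → Carrier → Carrier
    -_      : Carrier → Carrier
    0# 1#   : Carrier
    isCommutativeRing : IsCommutativeRing _≡_ _+_ _*_ -_ 0# 1#
    0≢1     : 0# ≢ 1#
    inverse : ∀ x → x ≢ 0# → ∃ λ y → x * y ≡ 1#

record IsFieldHom {c d : Level} (K : Field c) (E : Field d)
                  (ι : Field.Carrier K → Field.Carrier E) : Set (c ⊔ d) where
  private
    module K = Field K
    module E = Field E
  field
    +-hom : ∀ a b → ι (a K.+ b) ≡ ι a E.+ ι b
    *-hom : ∀ a b → ι (a K.* b) ≡ ι a E.* ι b
    1-hom : ι K.1# ≡ E.1#

-- Polynomials over a field, as coefficient lists (constant term first).

module Poly {c : Level} (K : Field c) where
  open Field K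

  Pol : Set c
  Pol = List Carrier

  coeff : Pol → ℕ → Carrier
  coeff []       _       = 0#
  coeff (a ∷ f)  zero    = a
  coeff (a ∷ f)  (suc k) = coeff f k

  -- equality of polynomials (up to trailing zero coefficients)
  _≈P_ : Pol → Pol → Set c
  f ≈P g = ∀ k → coeff f k ≡ coeff g k

  IsZeroPol : Pol → Set c
  IsZeroPol f = ∀ k → coeff f k ≡ 0#

  onePol : Pol
  onePol = 1# ∷ []

  scale : Carrier → Pol → Pol
  scale a []      = []
  scale a (b ∷ f) = (a * b) ∷ scale a f

  addPol : Pol → Pol → Pol
  addPol []      g       = g
  addPol (a ∷ f) []      = a ∷ f
  addPol (a ∷ f) (b ∷ g) = (a + b) ∷ addPol f g

  mulPol : Pol → Pol → Pol
  mulPol []      g = []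
  mulPol (a ∷ f) g = addPol (scale a g) (0# ∷ mulPol f g)

  _∣P_ : Pol → Pol → Set c
  g ∣P f = ∃ λ h → mulPol g h ≈P f

  HasDegree : Pol → ℕ → Set c
  HasDegree f d = (coeff f d ≢ 0#) × (∀ k → d < k → coeff f k ≡ 0#)

  Monic : Pol → Set c
  Monic f = ∃ λ d → (coeff f d ≡ 1#) × (∀ k → d < k → coeff f k ≡ 0#)

  module _ {d : Level} (E : Field d) (ι : Carrier → Field.Carrier E) where
    private module E = Field E
    eval : Pol → Field.Carrier E → Field.Carrier E
    eval []      x = E.0#
    eval (a ∷ f) x = ι a E.+ (x E.* eval f x)

    -- [K(α) : K] = s, i.e. the minimal polynomial of α over K has degree s:
    -- some monic polynomial of degree s vanishes at α, and no nonzero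
    -- polynomial of degree < s vanishes at α.
    DegreeOver : Field.Carrier E → ℕ → Set (c ⊔ d)
    DegreeOver α s =
      (∃ λ m → Monic m × HasDegree m s × eval m α ≡ E.0#)
      × (∀ f → ¬ IsZeroPol f → (∀ k → s ≤ k → coeff f k ≡ 0#) → eval f α ≢ E.0#)

  -- Tuples (f_1,…,f_{l+1}) with deg f_i ≤ t_i - 1: f_i is given by its
  -- t_i coefficients.
  Tuple : (n : ℕ) → (Fin n → ℕ) → Set c
  Tuple n t = (i : Fin n) → Vec Carrier (t i)

  pol : ∀ {m} → Vec Carrier m → Pol
  pol = toList

  -- reduced form: first non-zero polynomial monic, gcd = 1
  -- (the monic gcd is 1 iff every common divisor divides 1)
  ReducedForm : ∀ {n} (t : Fin n → ℕ) → Tuple n t → Set c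
  ReducedForm {n} t f =
    (∃ λ i → (∀ j → j <ᶠ i → IsZeroPol (pol (f j))) × Monic (pol (f i)))
    × (∀ g → (∀ i → g ∣P pol (f i)) → g ∣P onePol)

-- Projective space PG(n-1, E): nonzero vectors up to nonzero scalars.

module Proj {d : Level} (E : Field d) where
  open Field E

  NonZeroVec : ∀ {n} → (Fin n → Carrier) → Set d
  NonZeroVec v = ∃ λ i → v i ≢ 0#

  SamePoint : ∀ {n} → (Fin n → Carrier) → (Fin n → Carrier) → Set d
  SamePoint v w = ∃ λ a → (a ≢ 0#) × (∀ i → v i ≡ a * w i)

module Setup {c d : Level} (K : Field c) (E : Field d)
             (ι : Field.Carrier K → Field.Carrier E)
             (α : Field.Carrier E) (n : ℕ) (t : Fin n → ℕ) where
  open Poly K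
  open Proj E

  evalTuple : Tuple n t → Fin n → Field.Carrier E
  evalTuple f i = eval E ι (pol (f i)) α

  InL : (Fin n → Field.Carrier E) → Set (c ⊔ d)
  InL v = ∃ λ (f : Tuple n t) → NonZeroVec (evalTuple f) × SamePoint v (evalTuple f)

  S : Set c
  S = Σ (Tuple n t) (ReducedForm t)

  _≈S_ : S → S → Set c
  (f , _) ≈S (g , _) = ∀ i → f i ≡ g i

-- A reduced tuple x is sent to the point ⟨x(α)⟩. Conversely, a point of L is ⟨f(α)⟩ for a tuple f
-- with f(α) ≠ 0; dividing f by a gcd d = Σ uᵢ fᵢ of its entries and making the first nonzero quotient
-- monic gives a reduced tuple representing the same point, since deg d < s forces d(α) ≠ 0.
-- Two reduced tuples x, y with proportional values at α coincide: each xᵢ yⱼ − xⱼ yᵢ has degree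
-- ≤ tᵢ + tⱼ − 2 < s and vanishes at α, hence is 0; writing 1 = Σ vᵢ xᵢ gives y = (Σ vᵢ yᵢ) x, so
-- coprimality of y makes Σ vᵢ yᵢ a nonzero constant, and monicity makes it 1.

module Submission where

open import Defs

open import Algebra.Bundles using (CommutativeMonoid; CommutativeRing)
open import Data.Nat as ℕ using (ℕ; zero; suc; s≤s; z≤n)
import Data.Nat.Properties as ℕ
open import Data.Integer as ℤ using (ℤ; -[1+_]; _⊖_)
import Data.Integer.Properties as ℤ
import Data.Sign as Sign
open import Data.Maybe using (Maybe; just; nothing)
open import Relation.Nullary using (¬_; Dec; yes; no)
open import Relation.Binary.Definitions using (DecidableEquality; tri<; tri≈; tri>)
open import Data.Empty using (⊥-elim)
open import Data.Sum using (inj₁; inj₂)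
import Relation.Binary.Reasoning.Setoid
open import Relation.Binary.PropositionalEquality as ≡ using (_≡_; _≢_)
open import Data.Product using (Σ; ∃; _×_; _,_; proj₁; proj₂)
open import Function using (_∘_)
open import Data.Vec.Functional using (Vector)
open import Data.Fin using (Fin; zero; suc)
import Data.Fin as Fin
import Data.Fin.Properties as Fin
open import Data.List using ([]; _∷_; length)
open import Data.Vec using (Vec; []; _∷_)

-- Multiples come from
-- Mult.TCOptimised so that fromℤ 1 is 1# definitionally, which the solver's closing refl relies on.
module IntegerCoefficientSolver {a ℓ} (R : CommutativeRing a ℓ) where
  open CommutativeRing R
  open import Algebra.Properties.Ring ring
    using (-‿distribˡ-*; -‿distribʳ-*; -0#≈0#; -‿involutive; -‿+-comm)
  open import Algebra.Properties.CommutativeSemigroup +-commutativeSemigroup using (interchange)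
  open import Algebra.Properties.Semiring.Mult.TCOptimised semiring using (1+×; ×-homo-+; ×1-homo-*)
    renaming (_×_ to _·_)
  open import Algebra.Solver.Ring.AlmostCommutativeRing
    using (fromCommutativeRing; _-Raw-AlmostCommutative⟶_)
  import Algebra.Solver.Ring as Solver
  open import Relation.Binary.Reasoning.Setoid setoid

  fromℤ : ℤ → Carrier
  fromℤ (ℤ.+ n)   = n · 1#
  fromℤ -[1+ n ]  = - (suc n · 1#)

  fromℤ-⊖ : ∀ m n → fromℤ (m ⊖ n) ≈ m · 1# - n · 1#
  fromℤ-⊖ m       zero    = sym (trans (+-congˡ -0#≈0#) (+-identityʳ _))
  fromℤ-⊖ zero    (suc n) = sym (+-identityˡ _)
  fromℤ-⊖ (suc m) (suc n) = begin
    fromℤ (suc m ⊖ suc n)               ≡⟨ ≡.cong fromℤ (ℤ.[1+m]⊖[1+n]≡m⊖n m n) ⟩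
    fromℤ (m ⊖ n)                       ≈⟨ fromℤ-⊖ m n ⟩
    x - y                               ≈⟨ +-identityˡ _ ⟨
    0# + (x - y)                        ≈⟨ +-congʳ (-‿inverseʳ 1#) ⟨
    (1# - 1#) + (x - y)                 ≈⟨ interchange 1# (- 1#) x (- y) ⟩
    (1# + x) + (- 1# - y)               ≈⟨ +-congˡ (-‿+-comm 1# y) ⟩
    (1# + x) - (1# + y)                 ≈⟨ +-cong (1+× m 1#) (-‿cong (1+× n 1#)) ⟨
    suc m · 1# - suc n · 1#             ∎
    where
    x = m · 1#
    y = n · 1#

  fromℤ-+ : ∀ i j → fromℤ (i ℤ.+ j) ≈ fromℤ i + fromℤ j
  fromℤ-+ -[1+ m ] -[1+ n ] = begin
    - (suc (suc (m ℕ.+ n)) · 1#)        ≡⟨ ≡.cong (λ k → - (suc k · 1#)) (ℕ.+-suc m n) ⟨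
    - ((suc m ℕ.+ suc n) · 1#)          ≈⟨ -‿cong (×-homo-+ 1# (suc m) (suc n)) ⟩
    - (suc m · 1# + suc n · 1#)         ≈⟨ -‿+-comm _ _ ⟨
    fromℤ -[1+ m ] + fromℤ -[1+ n ]     ∎
  fromℤ-+ -[1+ m ] (ℤ.+ n)  = trans (fromℤ-⊖ n (suc m)) (+-comm _ _)
  fromℤ-+ (ℤ.+ m)  -[1+ n ] = fromℤ-⊖ m (suc n)
  fromℤ-+ (ℤ.+ m)  (ℤ.+ n)  = ×-homo-+ 1# m n

  fromℤ-◃⁺ : ∀ n → fromℤ (Sign.+ ℤ.◃ n) ≈ n · 1#
  fromℤ-◃⁺ zero    = refl
  fromℤ-◃⁺ (suc n) = refl

  fromℤ-◃⁻ : ∀ n → fromℤ (Sign.- ℤ.◃ n) ≈ - (n · 1#)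
  fromℤ-◃⁻ zero    = sym -0#≈0#
  fromℤ-◃⁻ (suc n) = refl

  fromℤ-* : ∀ i j → fromℤ (i ℤ.* j) ≈ fromℤ i * fromℤ j
  fromℤ-* (ℤ.+ m)  (ℤ.+ n)  = trans (fromℤ-◃⁺ (m ℕ.* n)) (×1-homo-* m n)
  fromℤ-* (ℤ.+ m)  -[1+ n ] =
    trans (fromℤ-◃⁻ (m ℕ.* suc n)) (trans (-‿cong (×1-homo-* m (suc n))) (-‿distribʳ-* _ _))
  fromℤ-* -[1+ m ] (ℤ.+ n)  =
    trans (fromℤ-◃⁻ (suc m ℕ.* n)) (trans (-‿cong (×1-homo-* (suc m) n)) (-‿distribˡ-* _ _))
  fromℤ-* -[1+ m ] -[1+ n ] = begin
    fromℤ (Sign.+ ℤ.◃ (suc m ℕ.* suc n)) ≈⟨ fromℤ-◃⁺ (suc m ℕ.* suc n) ⟩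
    (suc m ℕ.* suc n) · 1#               ≈⟨ ×1-homo-* (suc m) (suc n) ⟩
    x * y                                ≈⟨ -‿involutive _ ⟨
    - - (x * y)                          ≈⟨ -‿cong (-‿distribʳ-* x y) ⟩
    - (x * - y)                          ≈⟨ -‿distribˡ-* x (- y) ⟩
    - x * - y                            ∎
    where
    x = suc m · 1#
    y = suc n · 1#

  fromℤ-‿ : ∀ i → fromℤ (ℤ.- i) ≈ - fromℤ i
  fromℤ-‿ (ℤ.+ zero)  = sym -0#≈0#
  fromℤ-‿ (ℤ.+ suc n) = refl
  fromℤ-‿ -[1+ n ]    = sym (-‿involutive _)

  fromℤ-morphism : ℤ.+-*-rawRing -Raw-AlmostCommutative⟶ fromCommutativeRing R
  fromℤ-morphism = record
    { ⟦_⟧ = fromℤ ; +-homo = fromℤ-+ ; *-homo = fromℤ-* ; -‿homo = fromℤ-‿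
    ; 0-homo = refl ; 1-homo = refl }

  fromℤ-≟ : ∀ i j → Maybe (fromℤ i ≈ fromℤ j)
  fromℤ-≟ i j with i ℤ.≟ j
  ... | yes ≡.refl = just refl
  ... | no _       = nothing

  module RingSolver = Solver ℤ.+-*-rawRing (fromCommutativeRing R) fromℤ-morphism fromℤ-≟
  open RingSolver public using (solve; _:+_; _:*_; :-_; _:-_; _:=_)

  :0 :1 : ∀ {n} → RingSolver.Polynomial n
  :0 = RingSolver.con (ℤ.+ 0)
  :1 = RingSolver.con (ℤ.+ 1)

module LinearCombination {a ℓ} (R : CommutativeRing a ℓ) where
  open CommutativeRing R
  open import Algebra.Properties.Semiring.Sum semiring using (sum; sum-cong-≋; *-distribˡ-sum; *-distribʳ-sum)
  open import Algebra.Properties.CommutativeSemigroup *-commutativeSemigroup using (x∙yz≈y∙xz)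
  open import Relation.Binary.Reasoning.Setoid setoid

  infix 7 _·_
  _·_ : ∀ {n} → Vector Carrier n → Vector Carrier n → Carrier
  u · x = sum λ i → u i * x i

  ·-scaleˡ : ∀ {n} c (u x : Vector Carrier n) → (λ i → c * u i) · x ≈ c * (u · x)
  ·-scaleˡ c u x = begin
    sum (λ i → c * u i * x i)     ≈⟨ sum-cong-≋ (λ i → *-assoc c (u i) (x i)) ⟩
    sum (λ i → c * (u i * x i))   ≈⟨ *-distribˡ-sum c (λ i → u i * x i) ⟨
    c * (u · x)                   ∎

  ·-factorʳ : ∀ {n} g (u x q : Vector Carrier n) → (∀ i → x i ≈ g * q i) → u · x ≈ g * (u · q)
  ·-factorʳ g u x q x≈gq = begin
    sum (λ i → u i * x i)         ≈⟨ sum-cong-≋ (λ i → *-congˡ (x≈gq i)) ⟩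
    sum (λ i → u i * (g * q i))   ≈⟨ sum-cong-≋ (λ i → x∙yz≈y∙xz (u i) g (q i)) ⟩
    sum (λ i → g * (u i * q i))   ≈⟨ *-distribˡ-sum g (λ i → u i * q i) ⟨
    g * (u · q)                   ∎

  ·≈1∧cross⇒proportional : ∀ {n} (u x y : Vector Carrier n) → u · x ≈ 1# →
                           (∀ i j → x i * y j ≈ x j * y i) → ∀ j → y j ≈ x j * (u · y)
  ·≈1∧cross⇒proportional u x y u·x≈1 cross j = begin
    y j                              ≈⟨ *-identityˡ (y j) ⟨
    1# * y j                         ≈⟨ *-congʳ u·x≈1 ⟨
    (u · x) * y j                    ≈⟨ *-distribʳ-sum (y j) (λ i → u i * x i) ⟩
    sum (λ i → u i * x i * y j)      ≈⟨ sum-cong-≋ (λ i → *-assoc (u i) (x i) (y j)) ⟩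
    sum (λ i → u i * (x i * y j))    ≈⟨ sum-cong-≋ (λ i → *-congˡ (cross i j)) ⟩
    sum (λ i → u i * (x j * y i))    ≈⟨ sum-cong-≋ (λ i → x∙yz≈y∙xz (u i) (x j) (y i)) ⟩
    sum (λ i → x j * (u i * y i))    ≈⟨ *-distribˡ-sum (x j) (λ i → u i * y i) ⟨
    x j * (u · y)                    ∎

module FieldProperties {c} (K : Field c) where
  open Field K public using (0≢1; inverse)

  commutativeRing : CommutativeRing c c
  commutativeRing = record { isCommutativeRing = Field.isCommutativeRing K }

  open CommutativeRing commutativeRing public hiding (zero)
  open ≡.≡-Reasoning

  1≢0 : 1# ≢ 0#
  1≢0 = 0≢1 ∘ ≡.sym

  _⁻¹⟨_⟩ : (x : Carrier) → x ≢ 0# → Carrier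
  x ⁻¹⟨ x≢0 ⟩ = proj₁ (inverse x x≢0)

  x*x⁻¹≡1 : ∀ x (x≢0 : x ≢ 0#) → x * x ⁻¹⟨ x≢0 ⟩ ≡ 1#
  x*x⁻¹≡1 x x≢0 = proj₂ (inverse x x≢0)

  x⁻¹*x≡1 : ∀ x (x≢0 : x ≢ 0#) → x ⁻¹⟨ x≢0 ⟩ * x ≡ 1#
  x⁻¹*x≡1 x x≢0 = ≡.trans (*-comm _ x) (x*x⁻¹≡1 x x≢0)

  x*y≡0⇒y≡0 : ∀ {x y} → x ≢ 0# → x * y ≡ 0# → y ≡ 0#
  x*y≡0⇒y≡0 {x} {y} x≢0 xy≡0 = begin
    y                          ≡⟨ *-identityˡ y ⟨
    1# * y                     ≡⟨ ≡.cong (_* y) (x⁻¹*x≡1 x x≢0) ⟨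
    x ⁻¹⟨ x≢0 ⟩ * x * y        ≡⟨ *-assoc _ x y ⟩
    x ⁻¹⟨ x≢0 ⟩ * (x * y)      ≡⟨ ≡.cong (x ⁻¹⟨ x≢0 ⟩ *_) xy≡0 ⟩
    x ⁻¹⟨ x≢0 ⟩ * 0#           ≡⟨ zeroʳ _ ⟩
    0#                         ∎

  x*y⁻¹*y≡x : ∀ x {y} (y≢0 : y ≢ 0#) → x * y ⁻¹⟨ y≢0 ⟩ * y ≡ x
  x*y⁻¹*y≡x x {y} y≢0 = begin
    x * y ⁻¹⟨ y≢0 ⟩ * y      ≡⟨ *-assoc x _ y ⟩
    x * (y ⁻¹⟨ y≢0 ⟩ * y)    ≡⟨ ≡.cong (x *_) (x⁻¹*x≡1 y y≢0) ⟩
    x * 1#                   ≡⟨ *-identityʳ x ⟩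
    x                        ∎

  x*y≢0 : ∀ {x y} → x ≢ 0# → y ≢ 0# → x * y ≢ 0#
  x*y≢0 x≢0 y≢0 = y≢0 ∘ x*y≡0⇒y≡0 x≢0

  x⁻¹≢0 : ∀ x (x≢0 : x ≢ 0#) → x ⁻¹⟨ x≢0 ⟩ ≢ 0#
  x⁻¹≢0 x x≢0 x⁻¹≡0 = 1≢0 (begin
    1#                 ≡⟨ x*x⁻¹≡1 x x≢0 ⟨
    x * x ⁻¹⟨ x≢0 ⟩    ≡⟨ ≡.cong (x *_) x⁻¹≡0 ⟩
    x * 0#             ≡⟨ zeroʳ x ⟩
    0#                 ∎)

module PolynomialRing {c} (K : Field c) where
  open FieldProperties K
  open IntegerCoefficientSolver commutativeRing using (solve; _:+_; _:*_; :-_; _:=_; :0; :1)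
  open Poly K
  open ≡.≡-Reasoning

  -- A record rather than _≈P_ itself, so that f and g can be recovered from f ≋ g by unification.
  infix 4 _≋_
  record _≋_ (f g : Pol) : Set c where
    constructor coeffwise
    field coeff-≡ : f ≈P g
  open _≋_ public

  ≋-refl : ∀ {f} → f ≋ f
  ≋-refl = coeffwise λ _ → ≡.refl

  ≋-sym : ∀ {f g} → f ≋ g → g ≋ f
  ≋-sym (coeffwise f≈g) = coeffwise λ k → ≡.sym (f≈g k)

  ≋-trans : ∀ {f g h} → f ≋ g → g ≋ h → f ≋ h
  ≋-trans (coeffwise f≈g) (coeffwise g≈h) = coeffwise λ k → ≡.trans (f≈g k) (g≈h k)

  ∷-cong : ∀ {a b f g} → a ≡ b → f ≋ g → (a ∷ f) ≋ (b ∷ g)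
  ∷-cong a≡b (coeffwise f≈g) = coeffwise λ { zero → a≡b ; (suc k) → f≈g k }

  negPol : Pol → Pol
  negPol = scale (- 1#)

  coeff-addPol : ∀ f g k → coeff (addPol f g) k ≡ coeff f k + coeff g k
  coeff-addPol []      g       k       = ≡.sym (+-identityˡ _)
  coeff-addPol (a ∷ f) []      k       = ≡.sym (+-identityʳ _)
  coeff-addPol (a ∷ f) (b ∷ g) zero    = ≡.refl
  coeff-addPol (a ∷ f) (b ∷ g) (suc k) = coeff-addPol f g k

  coeff-scale : ∀ a f k → coeff (scale a f) k ≡ a * coeff f k
  coeff-scale a []      k       = ≡.sym (zeroʳ a)
  coeff-scale a (b ∷ f) zero    = ≡.refl
  coeff-scale a (b ∷ f) (suc k) = coeff-scale a f k

  addPol-cong : ∀ {f f′ g g′} → f ≋ f′ → g ≋ g′ → addPol f g ≋ addPol f′ g′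
  addPol-cong {f} {f′} {g} {g′} f≋f′ g≋g′ = coeffwise λ k → begin
    coeff (addPol f g) k       ≡⟨ coeff-addPol f g k ⟩
    coeff f k + coeff g k      ≡⟨ ≡.cong₂ _+_ (coeff-≡ f≋f′ k) (coeff-≡ g≋g′ k) ⟩
    coeff f′ k + coeff g′ k    ≡⟨ coeff-addPol f′ g′ k ⟨
    coeff (addPol f′ g′) k     ∎

  addPol-congʳ : ∀ f {g g′} → g ≋ g′ → addPol f g ≋ addPol f g′
  addPol-congʳ f = addPol-cong (≋-refl {f})

  scale-cong : ∀ {a b f g} → a ≡ b → f ≋ g → scale a f ≋ scale b g
  scale-cong {a} {b} {f} {g} a≡b f≋g = coeffwise λ k → begin
    coeff (scale a f) k        ≡⟨ coeff-scale a f k ⟩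
    a * coeff f k              ≡⟨ ≡.cong₂ _*_ a≡b (coeff-≡ f≋g k) ⟩
    b * coeff g k              ≡⟨ coeff-scale b g k ⟨
    coeff (scale b g) k        ∎

  addPol-comm : ∀ f g → addPol f g ≋ addPol g f
  addPol-comm f g = coeffwise λ k → begin
    coeff (addPol f g) k       ≡⟨ coeff-addPol f g k ⟩
    coeff f k + coeff g k      ≡⟨ +-comm _ _ ⟩
    coeff g k + coeff f k      ≡⟨ coeff-addPol g f k ⟨
    coeff (addPol g f) k       ∎

  addPol-assoc : ∀ f g h → addPol (addPol f g) h ≋ addPol f (addPol g h)
  addPol-assoc f g h = coeffwise λ k → begin
    coeff (addPol (addPol f g) h) k             ≡⟨ coeff-addPol (addPol f g) h k ⟩
    coeff (addPol f g) k + coeff h k            ≡⟨ ≡.cong (_+ coeff h k) (coeff-addPol f g k) ⟩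
    coeff f k + coeff g k + coeff h k           ≡⟨ +-assoc _ _ _ ⟩
    coeff f k + (coeff g k + coeff h k)         ≡⟨ ≡.cong (coeff f k +_) (coeff-addPol g h k) ⟨
    coeff f k + coeff (addPol g h) k            ≡⟨ coeff-addPol f (addPol g h) k ⟨
    coeff (addPol f (addPol g h)) k             ∎

  addPol-identityʳ : ∀ f → addPol f [] ≋ f
  addPol-identityʳ []      = ≋-refl
  addPol-identityʳ (a ∷ f) = ≋-refl

  negPol-inverseʳ : ∀ f → addPol f (negPol f) ≋ []
  negPol-inverseʳ f = coeffwise λ k → begin
    coeff (addPol f (negPol f)) k         ≡⟨ coeff-addPol f (negPol f) k ⟩
    coeff f k + coeff (negPol f) k        ≡⟨ ≡.cong (coeff f k +_) (coeff-scale (- 1#) f k) ⟩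
    coeff f k + - 1# * coeff f k          ≡⟨ solve 1 (λ x → x :+ :- :1 :* x := :0) ≡.refl (coeff f k) ⟩
    0#                                    ∎

  IsZeroPol⇒≋[] : ∀ f → IsZeroPol f → f ≋ []
  IsZeroPol⇒≋[] f = coeffwise

  IsZeroPol-scale : ∀ a f → IsZeroPol f → IsZeroPol (scale a f)
  IsZeroPol-scale a f f≈0 k = ≡.trans (coeff-scale a f k) (≡.trans (≡.cong (a *_) (f≈0 k)) (zeroʳ a))

  IsZeroPol-scale⁻¹ : ∀ {a} f → a ≢ 0# → IsZeroPol (scale a f) → IsZeroPol f
  IsZeroPol-scale⁻¹ {a} f a≢0 af≈0 k =
    x*y≡0⇒y≡0 a≢0 (≡.trans (≡.sym (coeff-scale a f k)) (af≈0 k))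

  Monic⇒¬IsZeroPol : ∀ f → Monic f → ¬ IsZeroPol f
  Monic⇒¬IsZeroPol f (d , lc≡1 , _) f≈0 = 1≢0 (≡.trans (≡.sym lc≡1) (f≈0 d))

  Monic⇒HasDegree : ∀ f (f-monic : Monic f) → HasDegree f (proj₁ f-monic)
  Monic⇒HasDegree f (d , lc≡1 , above) = (λ lc≡0 → 1≢0 (≡.trans (≡.sym lc≡1) lc≡0)) , above

  IsZeroPol-mulPolˡ : ∀ f g → IsZeroPol f → IsZeroPol (mulPol f g)
  IsZeroPol-mulPolˡ []      g f≈0 k = ≡.refl
  IsZeroPol-mulPolˡ (a ∷ f) g f≈0 k = begin
    coeff (addPol (scale a g) (0# ∷ mulPol f g)) k     ≡⟨ coeff-addPol (scale a g) _ k ⟩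
    coeff (scale a g) k + coeff (0# ∷ mulPol f g) k    ≡⟨ ≡.cong₂ _+_ (coeff-scale a g k) (shifted k) ⟩
    a * coeff g k + 0#                                 ≡⟨ ≡.cong (λ x → x * coeff g k + 0#) (f≈0 0) ⟩
    0# * coeff g k + 0#                                ≡⟨ solve 1 (λ x → :0 :* x :+ :0 := :0) ≡.refl (coeff g k) ⟩
    0#                                                 ∎
    where
    shifted : IsZeroPol (0# ∷ mulPol f g)
    shifted zero    = ≡.refl
    shifted (suc k) = IsZeroPol-mulPolˡ f g (f≈0 ∘ suc) k

  addPol-commutativeMonoid : CommutativeMonoid c c
  addPol-commutativeMonoid = record
    { Carrier = Pol ; _≈_ = _≋_ ; _∙_ = addPol ; ε = []
    ; isCommutativeMonoid = record
      { isMonoid = record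
        { isSemigroup = record
          { isMagma = record
            { isEquivalence = record { refl = ≋-refl ; sym = ≋-sym ; trans = ≋-trans }
            ; ∙-cong = addPol-cong }
          ; assoc = addPol-assoc }
        ; identity = (λ _ → ≋-refl) , addPol-identityʳ }
      ; comm = addPol-comm } }

  open import Algebra.Properties.CommutativeSemigroup
    (CommutativeMonoid.commutativeSemigroup addPol-commutativeMonoid)
    using (interchange) renaming (x∙yz≈y∙xz to addPol-leftComm)

  scale-distribˡ : ∀ a f g → scale a (addPol f g) ≋ addPol (scale a f) (scale a g)
  scale-distribˡ a f g = coeffwise λ k → begin
    coeff (scale a (addPol f g)) k               ≡⟨ coeff-scale a (addPol f g) k ⟩
    a * coeff (addPol f g) k                     ≡⟨ ≡.cong (a *_) (coeff-addPol f g k) ⟩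
    a * (coeff f k + coeff g k)                  ≡⟨ distribˡ a _ _ ⟩
    a * coeff f k + a * coeff g k                ≡⟨ ≡.cong₂ _+_ (coeff-scale a f k) (coeff-scale a g k) ⟨
    coeff (scale a f) k + coeff (scale a g) k    ≡⟨ coeff-addPol (scale a f) (scale a g) k ⟨
    coeff (addPol (scale a f) (scale a g)) k     ∎

  scale-distribʳ : ∀ a b f → scale (a + b) f ≋ addPol (scale a f) (scale b f)
  scale-distribʳ a b f = coeffwise λ k → begin
    coeff (scale (a + b) f) k                    ≡⟨ coeff-scale (a + b) f k ⟩
    (a + b) * coeff f k                          ≡⟨ distribʳ (coeff f k) a b ⟩
    a * coeff f k + b * coeff f k                ≡⟨ ≡.cong₂ _+_ (coeff-scale a f k) (coeff-scale b f k) ⟨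
    coeff (scale a f) k + coeff (scale b f) k    ≡⟨ coeff-addPol (scale a f) (scale b f) k ⟨
    coeff (addPol (scale a f) (scale b f)) k     ∎

  scale-assoc : ∀ a b f → scale a (scale b f) ≋ scale (a * b) f
  scale-assoc a b f = coeffwise λ k → begin
    coeff (scale a (scale b f)) k     ≡⟨ coeff-scale a (scale b f) k ⟩
    a * coeff (scale b f) k           ≡⟨ ≡.cong (a *_) (coeff-scale b f k) ⟩
    a * (b * coeff f k)               ≡⟨ *-assoc a b _ ⟨
    a * b * coeff f k                 ≡⟨ coeff-scale (a * b) f k ⟨
    coeff (scale (a * b) f) k         ∎

  scale-identityˡ : ∀ f → scale 1# f ≋ f
  scale-identityˡ f = coeffwise λ k → ≡.trans (coeff-scale 1# f k) (*-identityˡ _)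

  scale-zeroˡ : ∀ f → scale 0# f ≋ []
  scale-zeroˡ f = coeffwise λ k → ≡.trans (coeff-scale 0# f k) (zeroˡ _)

  shift-addPol : ∀ f g → (0# ∷ addPol f g) ≋ addPol (0# ∷ f) (0# ∷ g)
  shift-addPol f g = ∷-cong (≡.sym (+-identityˡ 0#)) ≋-refl

  mulPol-zeroʳ : ∀ f → mulPol f [] ≋ []
  mulPol-zeroʳ []      = ≋-refl
  mulPol-zeroʳ (a ∷ f) = coeffwise λ { zero → ≡.refl ; (suc k) → coeff-≡ (mulPol-zeroʳ f) k }

  mulPol-shiftˡ : ∀ f g → mulPol (0# ∷ f) g ≋ (0# ∷ mulPol f g)
  mulPol-shiftˡ f g = addPol-cong (scale-zeroˡ g) ≋-refl

  mulPol-congˡ : ∀ {f f′} g → f ≋ f′ → mulPol f g ≋ mulPol f′ g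
  mulPol-congˡ {[]}    {[]}      g f≋f′ = ≋-refl
  mulPol-congˡ {[]}    {a′ ∷ f′} g f≋f′ =
    ≋-sym (coeffwise (IsZeroPol-mulPolˡ (a′ ∷ f′) g (coeff-≡ (≋-sym f≋f′))))
  mulPol-congˡ {a ∷ f} {[]}      g f≋f′ = coeffwise (IsZeroPol-mulPolˡ (a ∷ f) g (coeff-≡ f≋f′))
  mulPol-congˡ {a ∷ f} {a′ ∷ f′} g (coeffwise f≈f′) =
    addPol-cong (scale-cong (f≈f′ 0) ≋-refl)
                (∷-cong ≡.refl (mulPol-congˡ {f} {f′} g (coeffwise (f≈f′ ∘ suc))))

  mulPol-∷ʳ : ∀ g a f → mulPol g (a ∷ f) ≋ addPol (scale a g) (0# ∷ mulPol g f)
  mulPol-∷ʳ []      a f = coeffwise λ { zero → ≡.refl ; (suc k) → ≡.refl }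
  mulPol-∷ʳ (b ∷ g) a f = ∷-cong (≡.cong (_+ 0#) (*-comm b a))
    (≋-trans (addPol-cong ≋-refl (mulPol-∷ʳ g a f))
             (addPol-leftComm (scale b f) (scale a g) (0# ∷ mulPol g f)))

  mulPol-comm : ∀ f g → mulPol f g ≋ mulPol g f
  mulPol-comm []      g = ≋-sym (mulPol-zeroʳ g)
  mulPol-comm (a ∷ f) g =
    ≋-trans (addPol-cong ≋-refl (∷-cong ≡.refl (mulPol-comm f g))) (≋-sym (mulPol-∷ʳ g a f))

  mulPol-distribʳ : ∀ h f g → mulPol (addPol f g) h ≋ addPol (mulPol f h) (mulPol g h)
  mulPol-distribʳ h []      g       = ≋-refl
  mulPol-distribʳ h (a ∷ f) []      = ≋-sym (addPol-identityʳ _)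
  mulPol-distribʳ h (a ∷ f) (b ∷ g) = ≋-trans
    (addPol-cong (scale-distribʳ a b h)
                 (≋-trans (∷-cong ≡.refl (mulPol-distribʳ h f g)) (shift-addPol (mulPol f h) (mulPol g h))))
    (interchange (scale a h) (scale b h) (0# ∷ mulPol f h) (0# ∷ mulPol g h))

  mulPol-scaleˡ : ∀ a f g → mulPol (scale a f) g ≋ scale a (mulPol f g)
  mulPol-scaleˡ a []      g = ≋-refl
  mulPol-scaleˡ a (b ∷ f) g = ≋-trans
    (addPol-cong (≋-sym (scale-assoc a b g))
                 (∷-cong (≡.sym (zeroʳ a)) (mulPol-scaleˡ a f g)))
    (≋-sym (scale-distribˡ a (scale b g) (0# ∷ mulPol f g)))

  mulPol-constantˡ : ∀ a f → mulPol (a ∷ []) f ≋ scale a f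
  mulPol-constantˡ a f =
    ≋-trans (addPol-congʳ (scale a f) (IsZeroPol⇒≋[] (0# ∷ []) λ { zero → ≡.refl ; (suc k) → ≡.refl }))
            (addPol-identityʳ (scale a f))

  mulPol-identityˡ : ∀ f → mulPol onePol f ≋ f
  mulPol-identityˡ f = ≋-trans (mulPol-constantˡ 1# f) (scale-identityˡ f)

  mulPol-assoc : ∀ f g h → mulPol (mulPol f g) h ≋ mulPol f (mulPol g h)
  mulPol-assoc []      g h = ≋-refl
  mulPol-assoc (a ∷ f) g h = ≋-trans (mulPol-distribʳ h (scale a g) (0# ∷ mulPol f g))
    (addPol-cong (mulPol-scaleˡ a g h)
                 (≋-trans (mulPol-shiftˡ (mulPol f g) h) (∷-cong ≡.refl (mulPol-assoc f g h))))

  mulPol-cong : ∀ {f f′ g g′} → f ≋ f′ → g ≋ g′ → mulPol f g ≋ mulPol f′ g′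
  mulPol-cong {f} {f′} {g} {g′} f≋f′ g≋g′ =
    ≋-trans (mulPol-congˡ g f≋f′)
      (≋-trans (mulPol-comm f′ g) (≋-trans (mulPol-congˡ f′ g≋g′) (mulPol-comm g′ f′)))

  polynomialRing : CommutativeRing c c
  polynomialRing = record
    { Carrier = Pol ; _≈_ = _≋_ ; _+_ = addPol ; _*_ = mulPol ; -_ = negPol ; 0# = [] ; 1# = onePol
    ; isCommutativeRing = record
      { isRing = record
        { +-isAbelianGroup = record
          { isGroup = record
            { isMonoid = CommutativeMonoid.isMonoid addPol-commutativeMonoid
            ; inverse = (λ f → ≋-trans (addPol-comm (negPol f) f) (negPol-inverseʳ f)) , negPol-inverseʳ
            ; ⁻¹-cong = scale-cong ≡.refl }
          ; comm = addPol-comm }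
        ; *-cong = mulPol-cong
        ; *-assoc = mulPol-assoc
        ; *-identity = mulPol-identityˡ , (λ f → ≋-trans (mulPol-comm f onePol) (mulPol-identityˡ f))
        ; distrib = (λ h f g → ≋-trans (mulPol-comm h (addPol f g))
                                 (≋-trans (mulPol-distribʳ h f g)
                                          (addPol-cong (mulPol-comm f h) (mulPol-comm g h))))
                  , mulPol-distribʳ }
      ; *-comm = mulPol-comm } }

  coeff-negPol : ∀ f k → coeff (negPol f) k ≡ - coeff f k
  coeff-negPol f k = ≡.trans (coeff-scale (- 1#) f k) (solve 1 (λ x → :- :1 :* x := :- x) ≡.refl (coeff f k))

  X : Pol
  X = 0# ∷ onePol

  ∷≋constant+X* : ∀ a f → (a ∷ f) ≋ addPol (a ∷ []) (mulPol X f)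
  ∷≋constant+X* a f = ≋-trans (∷-cong (≡.sym (+-identityʳ a)) ≋-refl)
    (addPol-congʳ (a ∷ []) (≋-sym (≋-trans (mulPol-shiftˡ onePol f)
                                           (∷-cong ≡.refl (mulPol-identityˡ f)))))

  DegreeBelow : Pol → ℕ → Set c
  DegreeBelow f n = ∀ k → n ℕ.≤ k → coeff f k ≡ 0#

  DegreeBelow-mono : ∀ f {m n} → m ℕ.≤ n → DegreeBelow f m → DegreeBelow f n
  DegreeBelow-mono f m≤n below k n≤k = below k (ℕ.≤-trans m≤n n≤k)

  DegreeBelow-addPol : ∀ f g {n} → DegreeBelow f n → DegreeBelow g n → DegreeBelow (addPol f g) n
  DegreeBelow-addPol f g f-below g-below k n≤k =
    ≡.trans (coeff-addPol f g k) (≡.trans (≡.cong₂ _+_ (f-below k n≤k) (g-below k n≤k)) (+-identityʳ 0#))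

  DegreeBelow-scale : ∀ a f {n} → DegreeBelow f n → DegreeBelow (scale a f) n
  DegreeBelow-scale a f f-below k n≤k =
    ≡.trans (coeff-scale a f k) (≡.trans (≡.cong (a *_) (f-below k n≤k)) (zeroʳ a))

  DegreeBelow-length : ∀ f → DegreeBelow f (length f)
  DegreeBelow-length []      k       _         = ≡.refl
  DegreeBelow-length (a ∷ f) (suc k) (s≤s n≤k) = DegreeBelow-length f k n≤k

  coeffVec : ∀ m → Pol → Vec Carrier m
  coeffVec zero    _       = []
  coeffVec (suc m) []      = 0# ∷ coeffVec m []
  coeffVec (suc m) (a ∷ f) = a ∷ coeffVec m f

  pol-coeffVec : ∀ m f → DegreeBelow f m → pol (coeffVec m f) ≋ f
  pol-coeffVec zero    f       f-below = ≋-sym (IsZeroPol⇒≋[] f λ k → f-below k z≤n)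
  pol-coeffVec (suc m) []      _       =
    coeffwise λ { zero → ≡.refl ; (suc k) → coeff-≡ (pol-coeffVec m [] λ _ _ → ≡.refl) k }
  pol-coeffVec (suc m) (a ∷ f) f-below =
    ∷-cong ≡.refl (pol-coeffVec m f λ k m≤k → f-below (suc k) (s≤s m≤k))

  DegreeBelow-pol : ∀ {m} (v : Vec Carrier m) → DegreeBelow (pol v) m
  DegreeBelow-pol []      k       _         = ≡.refl
  DegreeBelow-pol (a ∷ v) (suc k) (s≤s m≤k) = DegreeBelow-pol v k m≤k

  pol-injective : ∀ {m} (v w : Vec Carrier m) → pol v ≋ pol w → v ≡ w
  pol-injective []      []      _                = ≡.refl
  pol-injective (a ∷ v) (b ∷ w) (coeffwise v≈w) =
    ≡.cong₂ _∷_ (v≈w 0) (pol-injective v w (coeffwise (v≈w ∘ suc)))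

module PolynomialDegree {c} (K : Field c) (_≟_ : DecidableEquality (Field.Carrier K)) where
  open FieldProperties K
  open IntegerCoefficientSolver commutativeRing using (solve; _:+_; _:*_; _:=_; :0)
  open Poly K
  open PolynomialRing K
  open import Algebra.Properties.Ring (CommutativeRing.ring polynomialRing) using (x[y-z]≈xy-xz)
  open import Algebra.Properties.Group (CommutativeRing.+-group polynomialRing) using (x∙y⁻¹≈ε⇒x≈y)
  open ≡.≡-Reasoning

  isZeroPol? : ∀ f → Dec (IsZeroPol f)
  isZeroPol? []      = yes λ _ → ≡.refl
  isZeroPol? (a ∷ f) with a ≟ 0# | isZeroPol? f
  ... | yes a≡0 | yes f≈0 = yes λ { zero → a≡0 ; (suc k) → f≈0 k }
  ... | no  a≢0 | _       = no λ a∷f≈0 → a≢0 (a∷f≈0 0)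
  ... | yes _   | no  f≉0 = no λ a∷f≈0 → f≉0 (a∷f≈0 ∘ suc)

  degree : ∀ f → ¬ IsZeroPol f → ∃ (HasDegree f)
  degree []      f≉0 = ⊥-elim (f≉0 λ _ → ≡.refl)
  degree (a ∷ f) a∷f≉0 with isZeroPol? f
  ... | yes f≈0 = 0 , (λ a≡0 → a∷f≉0 λ { zero → a≡0 ; (suc k) → f≈0 k })
                    , λ { (suc k) _ → f≈0 k }
  ... | no  f≉0 with degree f f≉0
  ...   | d , lc≢0 , above = suc d , lc≢0 , λ { (suc k) (s≤s d<k) → above k d<k }

  IsZeroPol-resp-≋ : ∀ {f g} → f ≋ g → IsZeroPol f → IsZeroPol g
  IsZeroPol-resp-≋ (coeffwise f≈g) f≈0 k = ≡.trans (≡.sym (f≈g k)) (f≈0 k)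

  HasDegree-resp-≋ : ∀ {f g d} → f ≋ g → HasDegree f d → HasDegree g d
  HasDegree-resp-≋ {d = d} (coeffwise f≈g) (lc≢0 , above) =
    (λ lc≡0 → lc≢0 (≡.trans (f≈g d) lc≡0)) , λ k d<k → ≡.trans (≡.sym (f≈g k)) (above k d<k)

  HasDegree⇒¬IsZeroPol : ∀ f {d} → HasDegree f d → ¬ IsZeroPol f
  HasDegree⇒¬IsZeroPol f {d} (lc≢0 , _) f≈0 = lc≢0 (f≈0 d)

  HasDegree⇒DegreeBelow : ∀ f {d} → HasDegree f d → DegreeBelow f (suc d)
  HasDegree⇒DegreeBelow f (_ , above) = above

  HasDegree∧DegreeBelow⇒< : ∀ f {d n} → HasDegree f d → DegreeBelow f n → d ℕ.< n
  HasDegree∧DegreeBelow⇒< f {d} {n} (lc≢0 , _) below with n ℕ.≤? d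
  ... | yes n≤d = ⊥-elim (lc≢0 (below d n≤d))
  ... | no  n≰d = ℕ.≰⇒> n≰d

  HasDegree-unique : ∀ f {d e} → HasDegree f d → HasDegree f e → d ≡ e
  HasDegree-unique f {d} {e} (lc≢0 , above) (lc′≢0 , above′) with ℕ.<-cmp d e
  ... | tri< d<e _ _ = ⊥-elim (lc′≢0 (above e d<e))
  ... | tri≈ _ d≡e _ = d≡e
  ... | tri> _ _ e<d = ⊥-elim (lc≢0 (above′ d e<d))

  HasDegree-scale : ∀ {a} f {d} → a ≢ 0# → HasDegree f d → HasDegree (scale a f) d
  HasDegree-scale {a} f {d} a≢0 (lc≢0 , above) =
    (λ lc≡0 → x*y≢0 a≢0 lc≢0 (≡.trans (≡.sym (coeff-scale a f d)) lc≡0)) ,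
    λ k d<k → ≡.trans (coeff-scale a f k) (≡.trans (≡.cong (a *_) (above k d<k)) (zeroʳ a))

  HasDegree-mulPol : ∀ f g {m n} → HasDegree f m → HasDegree g n → HasDegree (mulPol f g) (m ℕ.+ n)
  HasDegree-mulPol []      g (lc≢0 , _) _ = ⊥-elim (lc≢0 ≡.refl)
  HasDegree-mulPol (a ∷ f) g {zero} (a≢0 , above) g-deg =
    HasDegree-resp-≋ (≋-sym fg≋ag) (HasDegree-scale g a≢0 g-deg)
    where
    fg≋ag : mulPol (a ∷ f) g ≋ scale a g
    fg≋ag = ≋-trans (addPol-cong ≋-refl (IsZeroPol⇒≋[] (0# ∷ mulPol f g) λ where
                                            zero    → ≡.refl
                                            (suc k) → IsZeroPol-mulPolˡ f g (λ j → above (suc j) (s≤s z≤n)) k))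
                    (addPol-identityʳ (scale a g))
  HasDegree-mulPol (a ∷ f) g {suc m} {n} (lc≢0 , above) g-deg@(_ , g-above) =
    (λ lc≡0 → proj₁ IH (≡.trans (≡.sym (shifted (m ℕ.+ n) ℕ.≤-refl)) lc≡0)) ,
    λ { (suc k) (s≤s m+n<k) → ≡.trans (shifted k (ℕ.<⇒≤ m+n<k)) (proj₂ IH k m+n<k) }
    where
    IH : HasDegree (mulPol f g) (m ℕ.+ n)
    IH = HasDegree-mulPol f g (lc≢0 , λ k m<k → above (suc k) (s≤s m<k)) g-deg
    shifted : ∀ k → m ℕ.+ n ℕ.≤ k → coeff (mulPol (a ∷ f) g) (suc k) ≡ coeff (mulPol f g) k
    shifted k m+n≤k = begin
      coeff (mulPol (a ∷ f) g) (suc k)                  ≡⟨ coeff-addPol (scale a g) (0# ∷ mulPol f g) (suc k) ⟩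
      coeff (scale a g) (suc k) + coeff (mulPol f g) k  ≡⟨ ≡.cong (_+ fg) (coeff-scale a g (suc k)) ⟩
      a * coeff g (suc k) + fg                          ≡⟨ ≡.cong (λ x → a * x + fg) g-vanishes ⟩
      a * 0# + fg                                       ≡⟨ solve 2 (λ a x → a :* :0 :+ x := x) ≡.refl a fg ⟩
      fg                                                ∎
      where
      fg = coeff (mulPol f g) k
      g-vanishes : coeff g (suc k) ≡ 0#
      g-vanishes = g-above (suc k) (s≤s (ℕ.≤-trans (ℕ.m≤n+m n m) m+n≤k))

  mulPol-¬IsZeroPol : ∀ f g → ¬ IsZeroPol f → ¬ IsZeroPol g → ¬ IsZeroPol (mulPol f g)
  mulPol-¬IsZeroPol f g f≉0 g≉0 with degree f f≉0 | degree g g≉0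
  ... | _ , f-deg | _ , g-deg = HasDegree⇒¬IsZeroPol (mulPol f g) (HasDegree-mulPol f g f-deg g-deg)

  IsZeroPol-mulPol⇒IsZeroPolʳ : ∀ d f → ¬ IsZeroPol d → IsZeroPol (mulPol d f) → IsZeroPol f
  IsZeroPol-mulPol⇒IsZeroPolʳ d f d≉0 df≈0 with isZeroPol? f
  ... | yes f≈0 = f≈0
  ... | no  f≉0 = ⊥-elim (mulPol-¬IsZeroPol d f d≉0 f≉0 df≈0)

  DegreeBelow-mulPol : ∀ f g {m n} → DegreeBelow f m → DegreeBelow g n →
                       DegreeBelow (mulPol f g) (ℕ.pred (m ℕ.+ n))
  DegreeBelow-mulPol f g f-below g-below with isZeroPol? f | isZeroPol? g
  ... | yes f≈0 | _       = λ k _ → IsZeroPol-mulPolˡ f g f≈0 k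
  ... | no  _   | yes g≈0 = λ k _ → ≡.trans (coeff-≡ (mulPol-comm f g) k) (IsZeroPol-mulPolˡ g f g≈0 k)
  ... | no  f≉0 | no  g≉0 with degree f f≉0 | degree g g≉0
  ...   | d , f-deg | e , g-deg =
    DegreeBelow-mono (mulPol f g)
      (ℕ.≤-trans (ℕ.≤-reflexive (≡.sym (ℕ.+-suc d e)))
                 (ℕ.pred-mono-≤ (ℕ.+-mono-≤ (HasDegree∧DegreeBelow⇒< f f-deg f-below)
                                            (HasDegree∧DegreeBelow⇒< g g-deg g-below))))
      (HasDegree⇒DegreeBelow (mulPol f g) (HasDegree-mulPol f g f-deg g-deg))

  DegreeBelow-cofactor : ∀ d h {f n} → ¬ IsZeroPol d → mulPol d h ≋ f → DegreeBelow f n → DegreeBelow h n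
  DegreeBelow-cofactor d h {f} d≉0 dh≋f f-below with isZeroPol? h
  ... | yes h≈0 = λ k _ → h≈0 k
  ... | no  h≉0 with degree d d≉0 | degree h h≉0
  ...   | e , d-deg | e′ , h-deg =
    DegreeBelow-mono h
      (ℕ.≤-trans (s≤s (ℕ.m≤n+m e′ e))
                 (HasDegree∧DegreeBelow⇒< f (HasDegree-resp-≋ dh≋f (HasDegree-mulPol d h d-deg h-deg))
                                            f-below))
      (HasDegree⇒DegreeBelow h h-deg)

  mulPol-cancelˡ : ∀ d {f g} → ¬ IsZeroPol d → mulPol d f ≋ mulPol d g → f ≋ g
  mulPol-cancelˡ d {f} {g} d≉0 df≋dg = x∙y⁻¹≈ε⇒x≈y f g
    (IsZeroPol⇒≋[] f-g (IsZeroPol-mulPol⇒IsZeroPolʳ d f-g d≉0 (coeff-≡ d[f-g]≋0)))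
    where
    f-g = addPol f (negPol g)
    d[f-g]≋0 : mulPol d (addPol f (negPol g)) ≋ []
    d[f-g]≋0 = ≋-trans (x[y-z]≈xy-xz d f g)
                 (≋-trans (addPol-cong df≋dg (≋-refl {negPol (mulPol d g)})) (negPol-inverseʳ (mulPol d g)))

  HasDegree-onePol : HasDegree onePol 0
  HasDegree-onePol = 1≢0 , λ { (suc k) _ → ≡.refl }

  mulPol≋onePol⇒HasDegree0 : ∀ f g → mulPol f g ≋ onePol → HasDegree f 0
  mulPol≋onePol⇒HasDegree0 f g fg≋1 with isZeroPol? f | isZeroPol? g
  ... | yes f≈0 | _       = ⊥-elim (1≢0 (≡.trans (≡.sym (coeff-≡ fg≋1 0))
                                                  (IsZeroPol-mulPolˡ f g f≈0 0)))
  ... | no  _   | yes g≈0 = ⊥-elim (1≢0 (≡.trans (≡.sym (coeff-≡ (≋-trans (mulPol-comm g f) fg≋1) 0))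
                                                  (IsZeroPol-mulPolˡ g f g≈0 0)))
  ... | no  f≉0 | no  g≉0 with degree f f≉0 | degree g g≉0
  ...   | d , f-deg | e , g-deg =
    ≡.subst (HasDegree f) (ℕ.m+n≡0⇒m≡0 d d+e≡0) f-deg
    where
    d+e≡0 : d ℕ.+ e ≡ 0
    d+e≡0 = HasDegree-unique onePol (HasDegree-resp-≋ fg≋1 (HasDegree-mulPol f g f-deg g-deg)) HasDegree-onePol

  HasDegree0⇒≋constant : ∀ f → HasDegree f 0 → f ≋ (coeff f 0 ∷ [])
  HasDegree0⇒≋constant f (_ , above) = coeffwise λ { zero → ≡.refl ; (suc k) → above (suc k) (s≤s z≤n) }

module PolynomialGcd {c} (K : Field c) (_≟_ : DecidableEquality (Field.Carrier K)) where
  open FieldProperties K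
  open Poly K
  open PolynomialRing K
  open PolynomialDegree K _≟_
  open IntegerCoefficientSolver commutativeRing using (solve; _:*_; _:-_; _:=_; :0)
  module P = IntegerCoefficientSolver polynomialRing
  open import Algebra.Definitions.RawMagma (CommutativeRing.*-rawMagma polynomialRing) using (_∣ˡ_; _,_)
  open import Algebra.Properties.Monoid.Divisibility (CommutativeRing.*-monoid polynomialRing) using (∣ˡ-refl)
  open import Algebra.Properties.Semigroup.Divisibility (CommutativeRing.*-semigroup polynomialRing)
    using (∣ˡ-trans)
  open LinearCombination polynomialRing using (_·_; ·-scaleˡ; ·-factorʳ; ·≈1∧cross⇒proportional)
  open import Relation.Binary.Reasoning.Setoid (CommutativeRing.setoid polynomialRing)

  record Division (f g : Pol) (n : ℕ) : Set c where
    field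
      quotient remainder : Pol
      f≋gq+r             : f ≋ addPol (mulPol g quotient) remainder
      remainder-below    : DegreeBelow remainder n

  -- From f = g q + r one gets a ∷ f = g (X q + b) + (a ∷ r − b g), where b cancels the coefficient
  -- of a ∷ r at n = deg g.
  divide : ∀ f g {n} → HasDegree g n → Division f g n
  divide []      g {n} g-deg = record
    { quotient = [] ; remainder = []
    ; f≋gq+r = ≋-sym (≋-trans (addPol-identityʳ (mulPol g [])) (mulPol-zeroʳ g))
    ; remainder-below = λ _ _ → ≡.refl }
  divide (a ∷ f) g {n} g-deg@(lc≢0 , g-above) = record
    { quotient = q′ ; remainder = r′ ; f≋gq+r = a∷f≋gq′+r′ ; remainder-below = r′-below }
    where
    open Division (divide f g g-deg) renaming (quotient to q; remainder to r; remainder-below to r-below)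
    lc = coeff g n
    b  = coeff (a ∷ r) n * lc ⁻¹⟨ lc≢0 ⟩
    q′ = addPol (mulPol X q) (b ∷ [])
    r′ = addPol (a ∷ r) (negPol (mulPol (b ∷ []) g))

    a∷f≋gq′+r′ : (a ∷ f) ≋ addPol (mulPol g q′) r′
    a∷f≋gq′+r′ = begin
      a ∷ f                                          ≈⟨ ∷≋constant+X* a f ⟩
      addPol (a ∷ []) (mulPol X f)
        ≈⟨ addPol-congʳ (a ∷ []) (mulPol-cong (≋-refl {X}) f≋gq+r) ⟩
      addPol (a ∷ []) (mulPol X (addPol (mulPol g q) r))
        ≈⟨ P.solve 6 (λ A X g q r B → A P.:+ X P.:* (g P.:* q P.:+ r)
                                       P.:= g P.:* (X P.:* q P.:+ B) P.:+ ((A P.:+ X P.:* r) P.:- B P.:* g))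
                     ≋-refl (a ∷ []) X g q r (b ∷ []) ⟩
      addPol (mulPol g q′) (addPol (addPol (a ∷ []) (mulPol X r)) (negPol (mulPol (b ∷ []) g)))
        ≈⟨ addPol-congʳ (mulPol g q′)
             (addPol-cong (≋-sym (∷≋constant+X* a r)) (≋-refl {negPol (mulPol (b ∷ []) g)})) ⟩
      addPol (mulPol g q′) r′                        ∎

    coeff-r′ : ∀ k → coeff r′ k ≡ coeff (a ∷ r) k - b * coeff g k
    coeff-r′ k = ≡.trans (coeff-addPol (a ∷ r) (negPol (mulPol (b ∷ []) g)) k)
      (≡.cong (coeff (a ∷ r) k +_)
        (≡.trans (coeff-negPol (mulPol (b ∷ []) g) k)
                 (≡.cong -_ (≡.trans (coeff-≡ (mulPol-constantˡ b g) k) (coeff-scale b g k)))))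

    r′-below : DegreeBelow r′ n
    r′-below k n≤k with ℕ.m≤n⇒m<n∨m≡n n≤k
    ... | inj₂ ≡.refl = ≡.trans (coeff-r′ n)
      (≡.trans (≡.cong (λ y → coeff (a ∷ r) n - y) (x*y⁻¹*y≡x (coeff (a ∷ r) n) lc≢0)) (-‿inverseʳ _))
    ... | inj₁ (s≤s n≤k′) = ≡.trans (coeff-r′ k)
      (≡.trans (≡.cong₂ (λ x y → x - b * y) (r-below _ n≤k′) (g-above k (s≤s n≤k′)))
               (solve 1 (λ b → :0 :- b :* :0 := :0) ≡.refl b))

  record Bezout (a b : Pol) : Set c where
    field
      gcd u v  : Pol
      gcd∣ˡa   : gcd ∣ˡ a
      gcd∣ˡb   : gcd ∣ˡ b
      identity : gcd ≋ addPol (mulPol u a) (mulPol v b)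

  bezout-zero : ∀ a b → IsZeroPol b → Bezout a b
  bezout-zero a b b≈0 = record
    { gcd = a ; u = onePol ; v = []
    ; gcd∣ˡa = ∣ˡ-refl
    ; gcd∣ˡb = [] , ≋-trans (mulPol-zeroʳ a) (≋-sym (IsZeroPol⇒≋[] b b≈0))
    ; identity = ≋-sym (≋-trans (addPol-identityʳ (mulPol onePol a)) (mulPol-identityˡ a)) }

  bezout-below : ∀ n a b → DegreeBelow b n → Bezout a b
  bezout-below zero    a b b-below = bezout-zero a b (λ k → b-below k z≤n)
  bezout-below (suc n) a b b-below with isZeroPol? b
  ... | yes b≈0 = bezout-zero a b b≈0
  ... | no  b≉0 with degree b b≉0
  ...   | m , b-deg = record
    { gcd = g ; u = v ; v = addPol u (negPol (mulPol v q))
    ; gcd∣ˡa = addPol (mulPol h q) h′ , g∣a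
    ; gcd∣ˡb = gcd∣ˡa
    ; identity = begin
        g                                                 ≈⟨ identity ⟩
        addPol (mulPol u b) (mulPol v r)
          ≈⟨ P.solve 5 (λ u b v r q → u P.:* b P.:+ v P.:* r
                                       P.:= v P.:* (b P.:* q P.:+ r) P.:+ (u P.:- v P.:* q) P.:* b)
                       ≋-refl u b v r q ⟩
        addPol (mulPol v (addPol (mulPol b q) r)) (mulPol (addPol u (negPol (mulPol v q))) b)
          ≈⟨ addPol-cong (mulPol-cong (≋-refl {v}) (≋-sym f≋gq+r))
                         (≋-refl {mulPol (addPol u (negPol (mulPol v q))) b}) ⟩
        addPol (mulPol v a) (mulPol (addPol u (negPol (mulPol v q))) b) ∎ }
    where
    open Division (divide a b b-deg) renaming (quotient to q; remainder to r)
    r-below : DegreeBelow r n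
    r-below = DegreeBelow-mono r (ℕ.≤-pred (HasDegree∧DegreeBelow⇒< b b-deg b-below)) remainder-below
    open Bezout (bezout-below n b r r-below) renaming (gcd to g)
    h  = _∣ˡ_.quotient gcd∣ˡa
    h′ = _∣ˡ_.quotient gcd∣ˡb
    g∣a : mulPol g (addPol (mulPol h q) h′) ≋ a
    g∣a = begin
      mulPol g (addPol (mulPol h q) h′)
        ≈⟨ P.solve 4 (λ g h q h′ → g P.:* (h P.:* q P.:+ h′) P.:= (g P.:* h) P.:* q P.:+ g P.:* h′)
                     ≋-refl g h q h′ ⟩
      addPol (mulPol (mulPol g h) q) (mulPol g h′)
        ≈⟨ addPol-cong (mulPol-cong (_∣ˡ_.equality gcd∣ˡa) (≋-refl {q})) (_∣ˡ_.equality gcd∣ˡb) ⟩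
      addPol (mulPol b q) r                               ≈⟨ f≋gq+r ⟨
      a                                                   ∎

  bezout : ∀ a b → Bezout a b
  bezout a b = bezout-below (length b) a b (DegreeBelow-length b)

  record GcdCombination {n} (x : Vector Pol n) : Set c where
    field
      gcd          : Pol
      gcd∣ˡ        : ∀ i → gcd ∣ˡ x i
      coefficients : Vector Pol n
      combination  : gcd ≋ coefficients · x

  gcdCombination : ∀ {n} (x : Vector Pol n) → GcdCombination x
  gcdCombination {zero}  x = record { gcd = [] ; gcd∣ˡ = λ () ; coefficients = λ () ; combination = ≋-refl }
  gcdCombination {suc n} x = record
    { gcd = Bezout.gcd B
    ; gcd∣ˡ = λ { zero → Bezout.gcd∣ˡb B ; (suc i) → ∣ˡ-trans (Bezout.gcd∣ˡa B) (gcd∣ˡ i) }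
    ; coefficients = λ { zero → Bezout.v B ; (suc i) → mulPol (Bezout.u B) (coefficients i) }
    ; combination = begin
        Bezout.gcd B                                                 ≈⟨ Bezout.identity B ⟩
        addPol (mulPol (Bezout.u B) gcd) (mulPol (Bezout.v B) (x zero))
          ≈⟨ addPol-comm (mulPol (Bezout.u B) gcd) (mulPol (Bezout.v B) (x zero)) ⟩
        addPol (mulPol (Bezout.v B) (x zero)) (mulPol (Bezout.u B) gcd)
          ≈⟨ addPol-congʳ (mulPol (Bezout.v B) (x zero))
               (≋-trans (mulPol-cong (≋-refl {Bezout.u B}) combination)
                        (≋-sym (·-scaleˡ (Bezout.u B) coefficients (x ∘ suc)))) ⟩
        addPol (mulPol (Bezout.v B) (x zero)) ((λ i → mulPol (Bezout.u B) (coefficients i)) · (x ∘ suc)) ∎ }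
    where
    open GcdCombination (gcdCombination (x ∘ suc))
    B = bezout gcd (x zero)

  ∣ˡ⇒∣P : ∀ {g f} → g ∣ˡ f → g ∣P f
  ∣ˡ⇒∣P (h , gh≋f) = h , coeff-≡ gh≋f

  Coprime : ∀ {n} → Vector Pol n → Set c
  Coprime x = ∀ g → (∀ i → g ∣P x i) → g ∣P onePol

  coprime⇒unimodular : ∀ {n} (x : Vector Pol n) → Coprime x → ∃ λ v → v · x ≋ onePol
  coprime⇒unimodular x x-coprime = (λ i → mulPol e (coefficients i)) , (begin
    (λ i → mulPol e (coefficients i)) · x     ≈⟨ ·-scaleˡ e coefficients x ⟩
    mulPol e (coefficients · x)               ≈⟨ mulPol-cong (≋-refl {e}) combination ⟨
    mulPol e gcd                              ≈⟨ mulPol-comm e gcd ⟩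
    mulPol gcd e                              ≈⟨ coeffwise gcd*e≈1 ⟩
    onePol                                    ∎)
    where
    open GcdCombination (gcdCombination x)
    e = proj₁ (x-coprime gcd (λ i → ∣ˡ⇒∣P (gcd∣ˡ i)))
    gcd*e≈1 = proj₂ (x-coprime gcd (λ i → ∣ˡ⇒∣P (gcd∣ˡ i)))

  unimodular⇒coprime : ∀ {n} (v x : Vector Pol n) → v · x ≋ onePol → Coprime x
  unimodular⇒coprime v x v·x≋1 g g∣x = v · q , coeff-≡ (begin
    mulPol g (v · q)     ≈⟨ ·-factorʳ g v x q (λ i → ≋-sym (coeffwise (proj₂ (g∣x i)))) ⟨
    v · x                ≈⟨ v·x≋1 ⟩
    onePol               ∎)
    where
    q = λ i → proj₁ (g∣x i)

  coprime∧cross⇒scalar : ∀ {n} (x y : Vector Pol n) → Coprime x → Coprime y →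
                         (∀ i j → mulPol (x i) (y j) ≋ mulPol (x j) (y i)) →
                         ∃ λ a → a ≢ 0# × ∀ i → y i ≋ scale a (x i)
  coprime∧cross⇒scalar x y x-coprime y-coprime cross =
    coeff (v · y) 0 , proj₁ C-constant , λ i → begin
      y i                               ≈⟨ ·≈1∧cross⇒proportional v x y v·x≋1 cross i ⟩
      mulPol (x i) (v · y)              ≈⟨ mulPol-comm (x i) (v · y) ⟩
      mulPol (v · y) (x i)              ≈⟨ mulPol-congˡ (x i) (HasDegree0⇒≋constant (v · y) C-constant) ⟩
      mulPol (coeff (v · y) 0 ∷ []) (x i) ≈⟨ mulPol-constantˡ (coeff (v · y) 0) (x i) ⟩
      scale (coeff (v · y) 0) (x i)     ∎
    where
    v     = proj₁ (coprime⇒unimodular x x-coprime)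
    v·x≋1 = proj₂ (coprime⇒unimodular x x-coprime)
    C∣1 : (v · y) ∣P onePol
    C∣1 = y-coprime (v · y) λ j → x j , coeff-≡ (≋-trans (mulPol-comm (v · y) (x j))
                                                         (≋-sym (·≈1∧cross⇒proportional v x y v·x≋1 cross j)))
    C-constant : HasDegree (v · y) 0
    C-constant = mulPol≋onePol⇒HasDegree0 (v · y) (proj₁ C∣1) (coeffwise (proj₂ C∣1))

module Evaluation {c d} (K : Field c) (E : Field d) (ι : Field.Carrier K → Field.Carrier E)
                  (ι-hom : IsFieldHom K E ι) where
  private
    module K = FieldProperties K
    module E = FieldProperties E
  open Poly K
  open PolynomialRing K
  open IsFieldHom ι-hom
  open IntegerCoefficientSolver E.commutativeRing using (solve; _:+_; _:*_; :-_; _:=_; :0; :1)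
  open import Algebra.Properties.Group E.+-group using (identityˡ-unique; inverseˡ-unique)
  open ≡.≡-Reasoning

  ev : Pol → E.Carrier → E.Carrier
  ev = eval E ι

  ι-0 : ι K.0# ≡ E.0#
  ι-0 = identityˡ-unique (ι K.0#) (ι K.0#)
          (≡.trans (≡.sym (+-hom K.0# K.0#)) (≡.cong ι (K.+-identityˡ K.0#)))

  ι-‿ : ∀ a → ι (K.- a) ≡ E.- ι a
  ι-‿ a = inverseˡ-unique (ι (K.- a)) (ι a)
    (≡.trans (≡.sym (+-hom (K.- a) a)) (≡.trans (≡.cong ι (K.-‿inverseˡ a)) ι-0))

  ι-≢0 : ∀ {a} → a ≢ K.0# → ι a ≢ E.0#
  ι-≢0 {a} a≢0 ιa≡0 = E.1≢0 (begin
    E.1#                             ≡⟨ 1-hom ⟨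
    ι K.1#                           ≡⟨ ≡.cong ι (K.x*x⁻¹≡1 a a≢0) ⟨
    ι (a K.* a K.⁻¹⟨ a≢0 ⟩)          ≡⟨ *-hom a _ ⟩
    ι a E.* ι (a K.⁻¹⟨ a≢0 ⟩)        ≡⟨ ≡.cong (E._* _) ιa≡0 ⟩
    E.0# E.* ι (a K.⁻¹⟨ a≢0 ⟩)       ≡⟨ E.zeroˡ _ ⟩
    E.0#                             ∎)

  ev-addPol : ∀ f g x → ev (addPol f g) x ≡ ev f x E.+ ev g x
  ev-addPol []      g       x = ≡.sym (E.+-identityˡ _)
  ev-addPol (a ∷ f) []      x = ≡.sym (E.+-identityʳ _)
  ev-addPol (a ∷ f) (b ∷ g) x = begin
    ι (a K.+ b) E.+ x E.* ev (addPol f g) x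
      ≡⟨ ≡.cong₂ (λ y z → y E.+ x E.* z) (+-hom a b) (ev-addPol f g x) ⟩
    ι a E.+ ι b E.+ x E.* (ev f x E.+ ev g x)
      ≡⟨ solve 5 (λ a b x p q → a :+ b :+ x :* (p :+ q) := a :+ x :* p :+ (b :+ x :* q))
                 ≡.refl (ι a) (ι b) x (ev f x) (ev g x) ⟩
    (ι a E.+ x E.* ev f x) E.+ (ι b E.+ x E.* ev g x)   ∎

  ev-scale : ∀ a f x → ev (scale a f) x ≡ ι a E.* ev f x
  ev-scale a []      x = ≡.sym (E.zeroʳ _)
  ev-scale a (b ∷ f) x = begin
    ι (a K.* b) E.+ x E.* ev (scale a f) x
      ≡⟨ ≡.cong₂ (λ y z → y E.+ x E.* z) (*-hom a b) (ev-scale a f x) ⟩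
    ι a E.* ι b E.+ x E.* (ι a E.* ev f x)
      ≡⟨ solve 4 (λ a b x p → a :* b :+ x :* (a :* p) := a :* (b :+ x :* p)) ≡.refl (ι a) (ι b) x (ev f x) ⟩
    ι a E.* (ι b E.+ x E.* ev f x)                ∎

  ev-negPol : ∀ f x → ev (negPol f) x ≡ E.- ev f x
  ev-negPol f x = begin
    ev (scale (K.- K.1#) f) x      ≡⟨ ev-scale (K.- K.1#) f x ⟩
    ι (K.- K.1#) E.* ev f x        ≡⟨ ≡.cong (E._* ev f x) (≡.trans (ι-‿ K.1#) (≡.cong E.-_ 1-hom)) ⟩
    E.- E.1# E.* ev f x            ≡⟨ solve 1 (λ y → :- :1 :* y := :- y) ≡.refl (ev f x) ⟩
    E.- ev f x                     ∎

  ev-mulPol : ∀ f g x → ev (mulPol f g) x ≡ ev f x E.* ev g x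
  ev-mulPol []      g x = ≡.sym (E.zeroˡ _)
  ev-mulPol (a ∷ f) g x = begin
    ev (addPol (scale a g) (K.0# ∷ mulPol f g)) x                ≡⟨ ev-addPol (scale a g) _ x ⟩
    ev (scale a g) x E.+ (ι K.0# E.+ x E.* ev (mulPol f g) x)
      ≡⟨ ≡.cong₂ (λ y w → y E.+ (ι K.0# E.+ x E.* w)) (ev-scale a g x) (ev-mulPol f g x) ⟩
    ι a E.* ev g x E.+ (ι K.0# E.+ x E.* (ev f x E.* ev g x))
      ≡⟨ ≡.cong (λ z → ι a E.* ev g x E.+ (z E.+ x E.* (ev f x E.* ev g x))) ι-0 ⟩
    ι a E.* ev g x E.+ (E.0# E.+ x E.* (ev f x E.* ev g x))
      ≡⟨ solve 4 (λ a q x p → a :* q :+ (:0 :+ x :* (p :* q)) := (a :+ x :* p) :* q)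
                 ≡.refl (ι a) (ev g x) x (ev f x) ⟩
    (ι a E.+ x E.* ev f x) E.* ev g x                            ∎

  ev-IsZeroPol : ∀ f x → IsZeroPol f → ev f x ≡ E.0#
  ev-IsZeroPol []      x f≈0 = ≡.refl
  ev-IsZeroPol (a ∷ f) x f≈0 = begin
    ι a E.+ x E.* ev f x
      ≡⟨ ≡.cong₂ (λ y z → ι y E.+ x E.* z) (f≈0 0) (ev-IsZeroPol f x (f≈0 ∘ suc)) ⟩
    ι K.0# E.+ x E.* E.0#     ≡⟨ ≡.cong₂ E._+_ ι-0 (E.zeroʳ x) ⟩
    E.0# E.+ E.0#             ≡⟨ E.+-identityˡ E.0# ⟩
    E.0#                      ∎

  ev-cong : ∀ {f g} x → f ≋ g → ev f x ≡ ev g x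
  ev-cong {[]}    {[]}    x f≋g = ≡.refl
  ev-cong {[]}    {b ∷ g} x f≋g = ≡.sym (ev-IsZeroPol (b ∷ g) x (coeff-≡ (≋-sym f≋g)))
  ev-cong {a ∷ f} {[]}    x f≋g = ev-IsZeroPol (a ∷ f) x (coeff-≡ f≋g)
  ev-cong {a ∷ f} {b ∷ g} x (coeffwise f≈g) =
    ≡.cong₂ (λ y z → ι y E.+ x E.* z) (f≈g 0) (ev-cong {f} {g} x (coeffwise (f≈g ∘ suc)))


module ProjectiveProperties {d} (E : Field d) where
  open FieldProperties E
  open Proj E
  open ≡.≡-Reasoning

  SamePoint-refl : ∀ {n} (v : Vector Carrier n) → SamePoint v v
  SamePoint-refl v = 1# , 1≢0 , λ i → ≡.sym (*-identityˡ (v i))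

  SamePoint-sym : ∀ {n} {v w : Vector Carrier n} → SamePoint v w → SamePoint w v
  SamePoint-sym {v = v} {w} (a , a≢0 , v≡aw) = a ⁻¹⟨ a≢0 ⟩ , x⁻¹≢0 a a≢0 , λ i → begin
    w i                          ≡⟨ *-identityˡ (w i) ⟨
    1# * w i                     ≡⟨ ≡.cong (_* w i) (x⁻¹*x≡1 a a≢0) ⟨
    a ⁻¹⟨ a≢0 ⟩ * a * w i        ≡⟨ *-assoc _ a (w i) ⟩
    a ⁻¹⟨ a≢0 ⟩ * (a * w i)      ≡⟨ ≡.cong (a ⁻¹⟨ a≢0 ⟩ *_) (v≡aw i) ⟨
    a ⁻¹⟨ a≢0 ⟩ * v i            ∎

  SamePoint-trans : ∀ {n} {u v w : Vector Carrier n} → SamePoint u v → SamePoint v w → SamePoint u w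
  SamePoint-trans {w = w} (a , a≢0 , u≡av) (b , b≢0 , v≡bw) = a * b , x*y≢0 a≢0 b≢0 , λ i →
    ≡.trans (u≡av i) (≡.trans (≡.cong (a *_) (v≡bw i)) (≡.sym (*-assoc a b (w i))))

¬∀⟶∃¬-least : ∀ {n p} (P : Fin n → Set p) → (∀ i → Dec (P i)) → ¬ (∀ i → P i) →
              ∃ λ i → ¬ P i × (∀ j → j Fin.< i → P j)
¬∀⟶∃¬-least {n} P P? ¬∀P with Fin.¬∀⟶∃¬-smallest n P P? ¬∀P
... | i , ¬Pi , P-below = i , ¬Pi , λ j j<i →
  ≡.subst P (Fin.toℕ-injective (≡.trans (Fin.toℕ-inject (Fin.fromℕ< j<i)) (Fin.toℕ-fromℕ< j<i)))
            (P-below (Fin.fromℕ< j<i))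

module ReducedRepresentatives
  {c d} (K : Field c) (E : Field d) (_≟_ : DecidableEquality (Field.Carrier K))
  (ι : Field.Carrier K → Field.Carrier E) (ι-hom : IsFieldHom K E ι) (α : Field.Carrier E) (s : ℕ)
  (α-nonroot : ∀ f → ¬ Poly.IsZeroPol K f → PolynomialRing.DegreeBelow K f s →
               Poly.eval K E ι f α ≢ Field.0# E)
  {n} (t : Fin n → ℕ) (t≤s : ∀ i → t i ℕ.≤ s)
  (t+t≤s+1 : ∀ i j → i ≢ j → t i ℕ.+ t j ℕ.≤ s ℕ.+ 1) where

  private
    module K = FieldProperties K
    module E = FieldProperties E
  open Poly K
  open PolynomialRing K
  open PolynomialDegree K _≟_
  open PolynomialGcd K _≟_
  open Evaluation K E ι ι-hom
  open Setup K E ι α n t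
  open Proj E
  open ProjectiveProperties E
  open IntegerCoefficientSolver E.commutativeRing using (solve; _:*_; _:-_; _:=_; :0)
  open import Algebra.Properties.Group (CommutativeRing.+-group polynomialRing) using (x∙y⁻¹≈ε⇒x≈y)
  open import Algebra.Definitions.RawMagma (CommutativeRing.*-rawMagma polynomialRing) using (_∣ˡ_)
  open LinearCombination polynomialRing using (_·_; ·-scaleˡ; ·-factorʳ)
  module SetoidReasoning = Relation.Binary.Reasoning.Setoid (CommutativeRing.setoid polynomialRing)

  ev≡0⇒IsZeroPol : ∀ f → DegreeBelow f s → ev f α ≡ E.0# → IsZeroPol f
  ev≡0⇒IsZeroPol f f-below fα≡0 with isZeroPol? f
  ... | yes f≈0 = f≈0
  ... | no  f≉0 = ⊥-elim (α-nonroot f f≉0 f-below fα≡0)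

  DegreeBelow-cross : ∀ {i j} → i ≢ j → (f : Vec K.Carrier (t i)) (g : Vec K.Carrier (t j)) →
                      DegreeBelow (mulPol (pol f) (pol g)) s
  DegreeBelow-cross {i} {j} i≢j f g =
    DegreeBelow-mono (mulPol (pol f) (pol g))
      (ℕ.≤-trans (ℕ.pred-mono-≤ (t+t≤s+1 i j i≢j)) (ℕ.≤-reflexive (≡.cong ℕ.pred (ℕ.+-comm s 1))))
      (DegreeBelow-mulPol (pol f) (pol g) (DegreeBelow-pol f) (DegreeBelow-pol g))

  cross-products : ∀ (x y : Tuple n t) → SamePoint (evalTuple x) (evalTuple y) →
                   ∀ i j → mulPol (pol (x i)) (pol (y j)) ≋ mulPol (pol (x j)) (pol (y i))
  cross-products x y (a , _ , x≡ay) i j with i Fin.≟ j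
  ... | yes ≡.refl = ≋-refl
  ... | no  i≢j    = x∙y⁻¹≈ε⇒x≈y P Q (IsZeroPol⇒≋[] D (ev≡0⇒IsZeroPol D D-below Dα≡0))
    where
    P = mulPol (pol (x i)) (pol (y j))
    Q = mulPol (pol (x j)) (pol (y i))
    D = addPol P (negPol Q)
    D-below : DegreeBelow D s
    D-below = DegreeBelow-addPol P (negPol Q) (DegreeBelow-cross i≢j (x i) (y j))
                (DegreeBelow-scale (K.- K.1#) Q (DegreeBelow-cross (i≢j ∘ ≡.sym) (x j) (y i)))
    Dα≡0 : ev D α ≡ E.0#
    Dα≡0 = begin
      ev D α                                               ≡⟨ ev-addPol P (negPol Q) α ⟩
      ev P α E.+ ev (negPol Q) α                           ≡⟨ ≡.cong (ev P α E.+_) (ev-negPol Q α) ⟩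
      ev P α E.- ev Q α                                    ≡⟨ ≡.cong₂ E._-_ (ev-mulPol (pol (x i)) (pol (y j)) α)
                                                                            (ev-mulPol (pol (x j)) (pol (y i)) α) ⟩
      evalTuple x i E.* evalTuple y j E.- evalTuple x j E.* evalTuple y i
        ≡⟨ ≡.cong₂ (λ u w → u E.* evalTuple y j E.- w E.* evalTuple y i) (x≡ay i) (x≡ay j) ⟩
      a E.* evalTuple y i E.* evalTuple y j E.- a E.* evalTuple y j E.* evalTuple y i
        ≡⟨ solve 3 (λ a u w → a :* u :* w :- a :* w :* u := :0) ≡.refl a (evalTuple y i) (evalTuple y j) ⟩
      E.0#                                                 ∎
      where open ≡.≡-Reasoning

  scalar-multiple⇒≈S : ∀ (x y : S) {a} → a ≢ K.0# →
                       (∀ i → pol (proj₁ y i) ≋ scale a (pol (proj₁ x i))) → x ≈S y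
  scalar-multiple⇒≈S (x , (i , x-zeros , x-monic) , _) (y , (j , y-zeros , y-monic) , _) {a} a≢0 y≋ax k =
    pol-injective (x k) (y k)
      (≋-sym (≋-trans (y≋ax k) (≋-trans (scale-cong a≡1 ≋-refl) (scale-identityˡ (pol (x k))))))
    where
    P Q : Fin n → Pol
    P k = pol (x k)
    Q k = pol (y k)

    i≡j : i ≡ j
    i≡j with Fin.<-cmp i j
    ... | tri< i<j _ _ = ⊥-elim (Monic⇒¬IsZeroPol (P i) x-monic
                           (IsZeroPol-scale⁻¹ (P i) a≢0 (IsZeroPol-resp-≋ (y≋ax i) (y-zeros i i<j))))
    ... | tri≈ _ i≡j _ = i≡j
    ... | tri> _ _ j<i = ⊥-elim (Monic⇒¬IsZeroPol (Q j) y-monic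
                           (IsZeroPol-resp-≋ (≋-sym (y≋ax j)) (IsZeroPol-scale a (P j) (x-zeros j j<i))))

    e = proj₁ x-monic
    Yᵢ-monic : Monic (Q i)
    Yᵢ-monic = ≡.subst (λ j → Monic (Q j)) (≡.sym i≡j) y-monic
    e≡e′ : e ≡ proj₁ Yᵢ-monic
    e≡e′ = HasDegree-unique (Q i)
             (HasDegree-resp-≋ (≋-sym (y≋ax i)) (HasDegree-scale (P i) a≢0 (Monic⇒HasDegree (P i) x-monic)))
             (Monic⇒HasDegree (Q i) Yᵢ-monic)

    a≡1 : a ≡ K.1#
    a≡1 = begin
      a                         ≡⟨ K.*-identityʳ a ⟨
      a K.* K.1#                ≡⟨ ≡.cong (a K.*_) (proj₁ (proj₂ x-monic)) ⟨
      a K.* coeff (P i) e       ≡⟨ coeff-scale a (P i) e ⟨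
      coeff (scale a (P i)) e   ≡⟨ coeff-≡ (y≋ax i) e ⟨
      coeff (Q i) e             ≡⟨ ≡.cong (coeff (Q i)) e≡e′ ⟩
      coeff (Q i) (proj₁ Yᵢ-monic) ≡⟨ proj₁ (proj₂ Yᵢ-monic) ⟩
      K.1#                      ∎
      where open ≡.≡-Reasoning

  reducedForm-unique : ∀ (x y : S) → SamePoint (evalTuple (proj₁ x)) (evalTuple (proj₁ y)) → x ≈S y
  reducedForm-unique x@(f , _ , f-coprime) y@(g , _ , g-coprime) x∼y
    with coprime∧cross⇒scalar (pol ∘ f) (pol ∘ g) f-coprime g-coprime (cross-products f g x∼y)
  ... | a , a≢0 , g≋af = scalar-multiple⇒≈S x y a≢0 g≋af

  evalTuple-InL : (x : S) → InL (evalTuple (proj₁ x))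
  evalTuple-InL (x , (i , _ , x-monic) , _) =
    x , (i , α-nonroot (pol (x i)) (Monic⇒¬IsZeroPol (pol (x i)) x-monic)
                       (DegreeBelow-mono (pol (x i)) (t≤s i) (DegreeBelow-pol (x i))))
      , SamePoint-refl (evalTuple x)

  module Reduction (f : Tuple n t) (f≉0 : NonZeroVec (evalTuple f)) where
    F : Vector Pol n
    F i = pol (f i)

    open GcdCombination (gcdCombination F)

    first-nonzero : ∃ λ i → ¬ IsZeroPol (F i) × (∀ j → j Fin.< i → IsZeroPol (F j))
    first-nonzero = ¬∀⟶∃¬-least (IsZeroPol ∘ F) (isZeroPol? ∘ F)
      λ F≈0 → proj₂ f≉0 (ev-IsZeroPol (F (proj₁ f≉0)) α (F≈0 (proj₁ f≉0)))

    i₀ = proj₁ first-nonzero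

    h : Vector Pol n
    h i = _∣ˡ_.quotient (gcd∣ˡ i)

    gcd*h≋F : ∀ i → mulPol gcd (h i) ≋ F i
    gcd*h≋F i = _∣ˡ_.equality (gcd∣ˡ i)

    gcd≉0 : ¬ IsZeroPol gcd
    gcd≉0 gcd≈0 = proj₁ (proj₂ first-nonzero)
      (IsZeroPol-resp-≋ (gcd*h≋F i₀) (IsZeroPol-mulPolˡ gcd (h i₀) gcd≈0))

    hᵢ₀≉0 : ¬ IsZeroPol (h i₀)
    hᵢ₀≉0 h≈0 = proj₁ (proj₂ first-nonzero)
      (IsZeroPol-resp-≋ (≋-trans (mulPol-comm (h i₀) gcd) (gcd*h≋F i₀)) (IsZeroPol-mulPolˡ (h i₀) gcd h≈0))

    e  = proj₁ (degree (h i₀) hᵢ₀≉0)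
    lc = coeff (h i₀) e
    lc≢0 : lc ≢ K.0#
    lc≢0 = proj₁ (proj₂ (degree (h i₀) hᵢ₀≉0))

    x : Tuple n t
    x i = coeffVec (t i) (scale (lc K.⁻¹⟨ lc≢0 ⟩) (h i))

    pol-x : ∀ i → pol (x i) ≋ scale (lc K.⁻¹⟨ lc≢0 ⟩) (h i)
    pol-x i = pol-coeffVec (t i) _ (DegreeBelow-scale _ (h i)
                (DegreeBelow-cofactor gcd (h i) gcd≉0 (gcd*h≋F i) (DegreeBelow-pol (f i))))

    h≋lc*x : ∀ i → h i ≋ mulPol (lc ∷ []) (pol (x i))
    h≋lc*x i = ≋-sym (begin
      mulPol (lc ∷ []) (pol (x i))                 ≈⟨ mulPol-constantˡ lc (pol (x i)) ⟩
      scale lc (pol (x i))                         ≈⟨ scale-cong ≡.refl (pol-x i) ⟩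
      scale lc (scale (lc K.⁻¹⟨ lc≢0 ⟩) (h i))     ≈⟨ scale-assoc lc _ (h i) ⟩
      scale (lc K.* lc K.⁻¹⟨ lc≢0 ⟩) (h i)         ≈⟨ scale-cong (K.x*x⁻¹≡1 lc lc≢0) ≋-refl ⟩
      scale K.1# (h i)                             ≈⟨ scale-identityˡ (h i) ⟩
      h i                                          ∎)
      where open SetoidReasoning

    coefficients·h≋1 : coefficients · h ≋ onePol
    coefficients·h≋1 = mulPol-cancelˡ gcd gcd≉0 (begin
      mulPol gcd (coefficients · h)    ≈⟨ ·-factorʳ gcd coefficients F h (λ i → ≋-sym (gcd*h≋F i)) ⟨
      coefficients · F                 ≈⟨ combination ⟨
      gcd                              ≈⟨ CommutativeRing.*-identityʳ polynomialRing gcd ⟨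
      mulPol gcd onePol                ∎)
      where open SetoidReasoning

    v : Vector Pol n
    v i = mulPol (lc ∷ []) (coefficients i)

    x-unimodular : v · (pol ∘ x) ≋ onePol
    x-unimodular = begin
      v · (pol ∘ x)                                ≈⟨ ·-scaleˡ (lc ∷ []) coefficients (pol ∘ x) ⟩
      mulPol (lc ∷ []) (coefficients · (pol ∘ x))  ≈⟨ ·-factorʳ (lc ∷ []) coefficients h (pol ∘ x) h≋lc*x ⟨
      coefficients · h                             ≈⟨ coefficients·h≋1 ⟩
      onePol                                       ∎
      where open SetoidReasoning

    xᵢ₀-monic : Monic (pol (x i₀))
    xᵢ₀-monic = e
              , ≡.trans (coeff-≡ (pol-x i₀) e) (≡.trans (coeff-scale _ (h i₀) e) (K.x⁻¹*x≡1 lc lc≢0))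
              , λ k e<k → ≡.trans (coeff-≡ (pol-x i₀) k) (DegreeBelow-scale _ (h i₀) hᵢ₀-above k e<k)
      where hᵢ₀-above = HasDegree⇒DegreeBelow (h i₀) (proj₂ (degree (h i₀) hᵢ₀≉0))

    x-reduced : ReducedForm t x
    x-reduced = (i₀ , x-zeros , xᵢ₀-monic) , unimodular⇒coprime v (pol ∘ x) x-unimodular
      where
      x-zeros : ∀ j → j Fin.< i₀ → IsZeroPol (pol (x j))
      x-zeros j j<i₀ = IsZeroPol-resp-≋ (≋-sym (pol-x j)) (IsZeroPol-scale _ (h j)
        (IsZeroPol-mulPol⇒IsZeroPolʳ gcd (h j) gcd≉0
          (IsZeroPol-resp-≋ (≋-sym (gcd*h≋F j)) (proj₂ (proj₂ first-nonzero) j j<i₀))))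

    gcd-below : DegreeBelow gcd s
    gcd-below = DegreeBelow-mono gcd (t≤s i₀)
      (DegreeBelow-cofactor (h i₀) gcd hᵢ₀≉0 (≋-trans (mulPol-comm (h i₀) gcd) (gcd*h≋F i₀))
                            (DegreeBelow-pol (f i₀)))

    f∼x : SamePoint (evalTuple f) (evalTuple x)
    f∼x = ev gcd α E.* ι lc , E.x*y≢0 (α-nonroot gcd gcd≉0 gcd-below) (ι-≢0 lc≢0) , λ i → begin
      ev (F i) α                                   ≡⟨ ev-cong α (gcd*h≋F i) ⟨
      ev (mulPol gcd (h i)) α                      ≡⟨ ev-mulPol gcd (h i) α ⟩
      ev gcd α E.* ev (h i) α
        ≡⟨ ≡.cong (ev gcd α E.*_) (ev-cong α (≋-trans (h≋lc*x i) (mulPol-constantˡ lc (pol (x i))))) ⟩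
      ev gcd α E.* ev (scale lc (pol (x i))) α     ≡⟨ ≡.cong (ev gcd α E.*_) (ev-scale lc (pol (x i)) α) ⟩
      ev gcd α E.* (ι lc E.* evalTuple x i)        ≡⟨ E.*-assoc (ev gcd α) (ι lc) (evalTuple x i) ⟨
      ev gcd α E.* ι lc E.* evalTuple x i          ∎
      where open ≡.≡-Reasoning

  reduce : (f : Tuple n t) → NonZeroVec (evalTuple f) →
           Σ S λ x → SamePoint (evalTuple f) (evalTuple (proj₁ x))
  reduce f f≉0 = (x , x-reduced) , f∼x
    where open Reduction f f≉0

open import Data.Nat using (ℕ; suc; _≤_; _+_; _^_)
open import Data.Fin using (Fin) renaming (_≤_ to _≤ᶠ_)
open import Data.Product using (Σ; ∃; ∃₂; _×_; _,_)
open import Function.Bundles using (_↔_)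
open import Relation.Nullary using (¬_)
open import Relation.Binary.PropositionalEquality using (_≡_; _≢_)
open import Function.Properties.Inverse using (↔-sym; ↔⇒↣)

lemma2p15 : {c d : _} (K : Field c) (E : Field d) (q h l s : ℕ)
    → Fin q ↔ Field.Carrier K
    → Fin (q ^ h) ↔ Field.Carrier E
    → 2 ≤ h → 1 ≤ l
    → (ι : Field.Carrier K → Field.Carrier E) → IsFieldHom K E ι
    → (α : Field.Carrier E) → ¬ (∃ λ a → ι a ≡ α)
    → Poly.DegreeOver K E ι α s
    → (t : Fin (suc l) → ℕ)
    → (∀ i → 1 ≤ t i) → (∀ i → t i ≤ h)
    → (∀ i j → i ≤ᶠ j → t i ≤ t j)
    → (∀ i j → i ≢ j → t i + t j ≤ s + 1)
    → let open Setup K E ι α (suc l) t in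
      let open Proj E in
      Σ (S → (Fin (suc l) → Field.Carrier E)) λ F →
      Σ ((v : Fin (suc l) → Field.Carrier E) → InL v → S) λ G →
        (∀ x → InL (F x))
        × (∀ v w (p : InL v) (p′ : InL w) → SamePoint v w → G v p ≈S G w p′)
        × (∀ v (p : InL v) → SamePoint (F (G v p)) v)
        × (∀ x (p : InL (F x)) → G (F x) p ≈S x)
-- Finiteness of K only
-- provides decidable equality of coefficients, and 1 ≤ l, 1 ≤ tⱼ serve to derive tᵢ ≤ s.
lemma2p15 K E q h (suc l) s K↔Fin _ _ (s≤s z≤n) ι ι-hom α _ (_ , α-nonroot) t 1≤t _ _ t+t≤s+1 =
  F , G , evalTuple-InL , G-resp-SamePoint , F∘G∼id , G∘F≈id
  where
  t≤s : ∀ i → t i ≤ s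
  t≤s i = ℕ.+-cancelʳ-≤ 1 (t i) s
            (ℕ.≤-trans (ℕ.+-monoʳ-≤ (t i) (1≤t j)) (t+t≤s+1 i j (≡.≢-sym (Fin.punchInᵢ≢i i zero))))
    where j = Fin.punchIn i zero

  open ReducedRepresentatives K E (Fin.inj⇒≟ (↔⇒↣ (↔-sym K↔Fin))) ι ι-hom α s α-nonroot t t≤s t+t≤s+1
  open Setup K E ι α (suc (suc l)) t
  open Proj E
  open ProjectiveProperties E

  F : S → Fin (suc (suc l)) → Field.Carrier E
  F x = evalTuple (proj₁ x)

  G : (v : Fin (suc (suc l)) → Field.Carrier E) → InL v → S
  G v (f , f≉0 , _) = proj₁ (reduce f f≉0)

  v∼FG : ∀ v (p : InL v) → SamePoint v (F (G v p))
  v∼FG v (f , f≉0 , v∼f) = SamePoint-trans v∼f (proj₂ (reduce f f≉0))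

  G-resp-SamePoint : ∀ v w (p : InL v) (p′ : InL w) → SamePoint v w → G v p ≈S G w p′
  G-resp-SamePoint v w p p′ v∼w =
    reducedForm-unique (G v p) (G w p′)
      (SamePoint-trans (SamePoint-sym (v∼FG v p)) (SamePoint-trans v∼w (v∼FG w p′)))

  F∘G∼id : ∀ v (p : InL v) → SamePoint (F (G v p)) v
  F∘G∼id v p = SamePoint-sym (v∼FG v p)

  G∘F≈id : ∀ x (p : InL (F x)) → G (F x) p ≈S x
  G∘F≈id x p = reducedForm-unique (G (F x) p) x (SamePoint-sym (v∼FG (F x) p))
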